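{- Let $n$ be a positive integer and let $\mathcal{H}$ be a finite collection of affine hyperplanes in $\mathbb{R}^n$ satisfying the following condition: for every $v\in \{0,1\}^n$ and every $i\in\{1,\dots,n\}$, there exists a hyperplane $H\in \mathcal{H}$ with $v\in H$ such that the $i$-th coordinate of the normal vector of $H$ is non-zero (i.e., writing $H=\{x\in\mathbb{R}^n : \langle a,x\rangle = b\}$ with $a\in\mathbb{R}^n\setminus\{0\}$, $b\in\mathbb{R}$, one has $a_i\neq 0$). Then $|\mathcal{H}|\ge n/2$.
   Context: An affine hyperplane in $\mathbb{R}^n$ is a set of the form $\{x\in\mathbb{R}^n : \langle a,x\rangle=b\}$ with $a\in\mathbb{R}^n\setminus\{0\}$ (its normal vector, determined up to a non-zero scalar multiple, so whether its $i$-th coordinate is non-zero is well defined) and $b\in\mathbb{R}$. -}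

module Defs where

open import Level using (Level; suc; _⊔_)
open import Algebra.Bundles using (CommutativeRing)
open import Relation.Binary.Structures using (IsStrictTotalOrder)
open import Relation.Nullary using (¬_)
open import Data.Product using (Σ; ∃; _×_; _,_)
open import Data.Sum using (_⊎_)
open import Data.Nat using (ℕ; zero) renaming (suc to sucℕ)
open import Data.Fin using (Fin) renaming (zero to fzero; suc to fsuc)
open import Data.Bool using (Bool; true; false)

-- The real numbers, axiomatised (up to isomorphism) as a Dedekind-complete
-- ordered field.  Equality is the setoid equality _≈_ of the ring.
record RealField (c ℓ : Level) : Set (suc (c ⊔ ℓ)) where
  field
    commRing : CommutativeRing c ℓ
  open CommutativeRing commRing public
  infix 4 _<_ _≤_
  field
    _<_ : Carrier → Carrier → Set ℓ
    <-isStrictTotalOrder : IsStrictTotalOrder _≈_ _<_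
    0≉1 : ¬ (0# ≈ 1#)
    inverse : ∀ x → ¬ (x ≈ 0#) → Σ Carrier (λ y → x * y ≈ 1#)
    +-monoˡ-< : ∀ {x y} z → x < y → x + z < y + z
    *-pos : ∀ {x y} → 0# < x → 0# < y → 0# < x * y

  _≤_ : Carrier → Carrier → Set ℓ
  x ≤ y = (x < y) ⊎ (x ≈ y)

  IsUpperBound : (Carrier → Set ℓ) → Carrier → Set (c ⊔ ℓ)
  IsUpperBound P u = ∀ x → P x → x ≤ u

  IsSupremum : (Carrier → Set ℓ) → Carrier → Set (c ⊔ ℓ)
  IsSupremum P s = IsUpperBound P s × (∀ u → IsUpperBound P u → s ≤ u)

  field
    completeness : (P : Carrier → Set ℓ) → ∃ P → ∃ (IsUpperBound P) →
                   ∃ (IsSupremum P)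

module _ {c ℓ : Level} (ℝ : RealField c ℓ) where
  open RealField ℝ

  sumFin : ∀ {n} → (Fin n → Carrier) → Carrier
  sumFin {zero} f = 0#
  sumFin {sucℕ n} f = f fzero + sumFin (λ i → f (fsuc i))

  dot : ∀ {n} → (Fin n → Carrier) → (Fin n → Carrier) → Carrier
  dot a x = sumFin (λ i → a i * x i)

  record Hyperplane (n : ℕ) : Set (c ⊔ ℓ) where
    field
      normal : Fin n → Carrier
      offset : Carrier
      normal≠0 : ¬ (∀ i → normal i ≈ 0#)
  open Hyperplane public

  _∈H_ : ∀ {n} → (Fin n → Carrier) → Hyperplane n → Set ℓ
  x ∈H H = dot (normal H) x ≈ offset H

  bit : Bool → Carrier
  bit false = 0#
  bit true = 1#

  cubePt : ∀ {n} → (Fin n → Bool) → Fin n → Carrier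
  cubePt v i = bit (v i)

module Submission where

-- Suppose 2m < n and let u be a vertex of the cube lying on as few of the hyperplanes as
-- possible. For each coordinate i let first i be the least j such that H j contains u and
-- a j i ≠ 0, and record the sign of the change of ⟨a (first i), x⟩ when x i is flipped at u.
-- More than m coordinates share a sign σ; call their set S. The product g of the forms
-- ⟨a j, x⟩ - b j of the hyperplanes missing u has degree at most m < |S|, so its alternating
-- sum over the face of the cube through u in the directions S vanishes. But g u ≠ 0, and g
-- vanishes at every other vertex w of that face: otherwise every hyperplane through w passes
-- through u, while for j the least first i over the coordinates where w differs from u, the
-- nonzero terms of ⟨a j, w - u⟩ all have sign σ and there is one, so H j contains u but not w
-- and w lies on fewer hyperplanes than u. Hence the alternating sum is ± g u ≠ 0.

open import Defs
open import Level using (Level; _⊔_)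
open import Function using (_∘_; _on_)
open import Data.Empty using (⊥; ⊥-elim)
open import Data.Bool as Bool using (Bool; true; false; not)
open import Data.Bool.Properties using (not-¬)
open import Data.Nat as ℕ using (ℕ; zero; suc; s≤s)
import Data.Nat.Properties as ℕₚ
open import Data.Nat.Induction using (<-wellFounded)
open import Data.Fin as Fin using (Fin; inject; fromℕ<) renaming (zero to fzero; suc to fsuc)
import Data.Fin.Properties as Finₚ
open import Data.Fin.Subset using (Subset; inside; outside; _∈_; _∉_; _⊆_; ∣_∣)
open import Data.Fin.Subset.Properties using (p⊂q⇒∣p∣<∣q∣; _∈?_)
open import Data.Vec using ([]; _∷_; here; there; tabulate)
open import Data.Vec.Properties using (lookup∘tabulate; []=⇒lookup; lookup⇒[]=)
open import Data.Vec.Functional using (head; tail) renaming (_∷_ to _◂_)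
open import Data.Product using (Σ; ∃; _×_; _,_; proj₁; proj₂)
open import Data.Sum using (inj₁; inj₂)
open import Data.Maybe using (nothing)
open import Relation.Nullary using (¬_; yes; no; does; contradiction)
open import Relation.Nullary.Decidable using (dec-true; dec-false; decidable-stable; ¬?; _×-dec_)
open import Relation.Unary using (Pred; Decidable)
open import Relation.Binary.PropositionalEquality as ≡ using (_≡_; _≢_; _≗_)
open import Relation.Binary.Definitions using (tri<; tri≈; tri>)
open import Relation.Binary.Structures using (IsStrictTotalOrder)
open import Relation.Binary.Construct.On using (wellFounded)
open import Induction.WellFounded using (Acc; acc)
open import Tactic.RingSolver using (solve-∀)
open import Tactic.RingSolver.Core.AlmostCommutativeRing using (AlmostCommutativeRing; fromCommutativeRing)

subsetOf : ∀ {n p} {P : Pred (Fin n) p} → Decidable P → Subset n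
subsetOf P? = tabulate (does ∘ P?)

module _ {n p} {P : Pred (Fin n) p} (P? : Decidable P) where

  ∈-subsetOf⁺ : ∀ {i} → P i → i ∈ subsetOf P?
  ∈-subsetOf⁺ {i} Pi = lookup⇒[]= i _ (≡.trans (lookup∘tabulate _ i) (dec-true (P? i) Pi))

  ∈-subsetOf⁻ : ∀ {i} → i ∈ subsetOf P? → P i
  ∈-subsetOf⁻ {i} i∈P = decidable-stable (P? i) λ ¬Pi → contradiction
    (≡.trans (≡.sym ([]=⇒lookup i∈P)) (≡.trans (lookup∘tabulate _ i) (dec-false (P? i) ¬Pi))) λ ()

fibre : ∀ {n} → (Fin n → Bool) → Bool → Subset n
fibre s σ = subsetOf (λ i → s i Bool.≟ σ)

∣fibre-true∣+∣fibre-false∣≡n : ∀ {n} (s : Fin n → Bool) → ∣ fibre s true ∣ ℕ.+ ∣ fibre s false ∣ ≡ n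
∣fibre-true∣+∣fibre-false∣≡n {zero} s = ≡.refl
∣fibre-true∣+∣fibre-false∣≡n {suc n} s with s fzero
... | true  = ≡.cong suc (∣fibre-true∣+∣fibre-false∣≡n (s ∘ fsuc))
... | false = ≡.trans (ℕₚ.+-suc _ _) (≡.cong suc (∣fibre-true∣+∣fibre-false∣≡n (s ∘ fsuc)))

majority : ∀ {n m} (s : Fin n → Bool) → 2 ℕ.* m ℕ.< n → ∃ λ σ → m ℕ.< ∣ fibre s σ ∣
majority {n} {m} s 2m<n with m ℕ.<? ∣ fibre s true ∣
... | yes m<∣t∣ = true , m<∣t∣
... | no m≮∣t∣ = false , ℕₚ.≰⇒> λ ∣f∣≤m → ℕₚ.<⇒≱ 2m<n (begin
  n                                        ≡⟨ ∣fibre-true∣+∣fibre-false∣≡n s ⟨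
  ∣ fibre s true ∣ ℕ.+ ∣ fibre s false ∣  ≤⟨ ℕₚ.+-mono-≤ (ℕₚ.≮⇒≥ m≮∣t∣) ∣f∣≤m ⟩
  m ℕ.+ m                                  ≡⟨ ≡.cong (m ℕ.+_) (ℕₚ.+-identityʳ m) ⟨
  2 ℕ.* m                                  ∎)
  where open ℕₚ.≤-Reasoning

smallest-witness : ∀ {m p} {P : Pred (Fin m) p} → Decidable P → ∃ P →
                   ∃ λ j → P j × (∀ {k} → k Fin.< j → ¬ P k)
smallest-witness {m} {P = P} P? (j , Pj)
  with Finₚ.¬∀⟶∃¬-smallest m (¬_ ∘ P) (¬? ∘ P?) (λ ∀¬P → ∀¬P j Pj)
... | i , ¬¬Pi , ¬P-below = i , decidable-stable (P? i) ¬¬Pi , λ {k} k<i →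
  ≡.subst (¬_ ∘ P) (inject-fromℕ< k<i) (¬P-below (fromℕ< k<i))
  where
  inject-fromℕ< : ∀ {k} (k<i : k Fin.< i) → inject (fromℕ< k<i) ≡ k
  inject-fromℕ< k<i = Finₚ.toℕ-injective (≡.trans (Finₚ.toℕ-inject _) (Finₚ.toℕ-fromℕ< k<i))

Vertex : ℕ → Set
Vertex n = Fin n → Bool

OnFace : ∀ {n} → Subset n → Vertex n → Vertex n → Set
OnFace S u w = ∀ i → i ∉ S → w i ≡ u i

head◂-≗ : ∀ {n} {u : Vertex (suc n)} {w} → w ≗ tail u → (head u ◂ w) ≗ u
head◂-≗ w≗ fzero    = ≡.refl
head◂-≗ w≗ (fsuc i) = w≗ i

onFace-outside : ∀ {n} {S : Subset n} {u w} → OnFace S (tail u) w → OnFace (outside ∷ S) u (head u ◂ w)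
onFace-outside w∈F fzero    _   = ≡.refl
onFace-outside w∈F (fsuc i) i∉ = w∈F i (i∉ ∘ there)

onFace-inside : ∀ {n} {S : Subset n} {u w} b → OnFace S (tail u) w → OnFace (inside ∷ S) u (b ◂ w)
onFace-inside b w∈F fzero    0∉ = contradiction here 0∉
onFace-inside b w∈F (fsuc i) i∉ = w∈F i (i∉ ∘ there)

module _ {c ℓ : Level} (ℝ : RealField c ℓ) where

  -- Without a zero test on coefficients the solver proves only identities free of cancellation.
  solverRing : AlmostCommutativeRing c ℓ
  solverRing = fromCommutativeRing (RealField.commRing ℝ) (λ _ → nothing)

  module RingIdentities where
    open AlmostCommutativeRing solverRing

    [x+y]-[z+w]≈[x-z]+[y-w] : ∀ x y z w → (x + y) + - (z + w) ≈ (x + - z) + (y + - w)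
    [x+y]-[z+w]≈[x-z]+[y-w] = solve-∀ solverRing

    [x+y]+z≈y+[x+z] : ∀ x y z → (x + y) + z ≈ y + (x + z)
    [x+y]+z≈y+[x+z] = solve-∀ solverRing

    [x+y]+z≈[y+z]+x : ∀ x y z → (x + y) + z ≈ (y + z) + x
    [x+y]+z≈[y+z]+x = solve-∀ solverRing

    x[yz]≈y[xz] : ∀ x y z → x * (y * z) ≈ y * (x * z)
    x[yz]≈y[xz] = solve-∀ solverRing

  open RealField ℝ
  open RingIdentities
  open IsStrictTotalOrder <-isStrictTotalOrder
    using (_≟_; _<?_; compare; irrefl; <-respˡ-≈; <-respʳ-≈) renaming (trans to <-trans)
  open import Algebra.Properties.Ring ring
    using (-0#≈0#; -‿involutive; -‿+-comm; -‿distribˡ-*; x[y-z]≈xy-xz; x∙y⁻¹≈ε⇒x≈y; x≈y⇒x∙y⁻¹≈ε)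
  open import Relation.Binary.Reasoning.Setoid setoid

  1≉0 : ¬ (1# ≈ 0#)
  1≉0 1≈0 = 0≉1 (sym 1≈0)

  *-≉0 : ∀ {x y} → ¬ (x ≈ 0#) → ¬ (y ≈ 0#) → ¬ (x * y ≈ 0#)
  *-≉0 {x} {y} x≉0 y≉0 xy≈0 with inverse x x≉0
  ... | x⁻¹ , xx⁻¹≈1 = y≉0 (begin
    y              ≈⟨ *-identityˡ y ⟨
    1# * y         ≈⟨ *-congʳ xx⁻¹≈1 ⟨
    (x * x⁻¹) * y  ≈⟨ *-congʳ (*-comm x x⁻¹) ⟩
    (x⁻¹ * x) * y  ≈⟨ *-assoc x⁻¹ x y ⟩
    x⁻¹ * (x * y)  ≈⟨ *-congˡ xy≈0 ⟩
    x⁻¹ * 0#       ≈⟨ zeroʳ x⁻¹ ⟩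
    0#             ∎)

  x[p-q]+[-y]q≈xp-[x+y]q : ∀ x y p q → x * (p - q) + - y * q ≈ x * p - (x + y) * q
  x[p-q]+[-y]q≈xp-[x+y]q x y p q = begin
    x * (p - q) + - y * q            ≈⟨ +-cong (x[y-z]≈xy-xz x p q) (sym (-‿distribˡ-* y q)) ⟩
    (x * p - x * q) + - (y * q)      ≈⟨ +-assoc (x * p) (- (x * q)) (- (y * q)) ⟩
    x * p + (- (x * q) + - (y * q))  ≈⟨ +-congˡ (-‿+-comm (x * q) (y * q)) ⟩
    x * p - (x * q + y * q)          ≈⟨ +-congˡ (-‿cong (distribʳ q x y)) ⟨
    x * p - (x + y) * q              ∎

  ≤-respʳ-≈ : ∀ {x y z} → y ≈ z → x ≤ y → x ≤ z
  ≤-respʳ-≈ y≈z (inj₁ x<y) = inj₁ (<-respʳ-≈ y≈z x<y)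
  ≤-respʳ-≈ y≈z (inj₂ x≈y) = inj₂ (trans x≈y y≈z)

  ≤-<-trans : ∀ {x y z} → x ≤ y → y < z → x < z
  ≤-<-trans (inj₁ x<y) y<z = <-trans x<y y<z
  ≤-<-trans (inj₂ x≈y) y<z = <-respˡ-≈ (sym x≈y) y<z

  +-pos-nonneg : ∀ {x y} → 0# < x → 0# ≤ y → 0# < x + y
  +-pos-nonneg {x} {y} 0<x 0≤y = ≤-<-trans (≤-respʳ-≈ (sym (+-identityˡ y)) 0≤y) (+-monoˡ-< y 0<x)

  +-nonneg : ∀ {x y} → 0# ≤ x → 0# ≤ y → 0# ≤ x + y
  +-nonneg (inj₁ 0<x) 0≤y = inj₁ (+-pos-nonneg 0<x 0≤y)
  +-nonneg {x} {y} (inj₂ 0≈x) 0≤y = ≤-respʳ-≈ (trans (sym (+-identityˡ y)) (+-congʳ 0≈x)) 0≤y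

  neg-pos : ∀ {x} → x < 0# → 0# < - x
  neg-pos {x} x<0 = <-respˡ-≈ (-‿inverseʳ x) (<-respʳ-≈ (+-identityˡ (- x)) (+-monoˡ-< (- x) x<0))

  negateIf : Bool → Carrier → Carrier
  negateIf false x = x
  negateIf true  x = - x

  negateIf-cong : ∀ b {x y} → x ≈ y → negateIf b x ≈ negateIf b y
  negateIf-cong false x≈y = x≈y
  negateIf-cong true  x≈y = -‿cong x≈y

  negateIf-≈0 : ∀ b {x} → x ≈ 0# → negateIf b x ≈ 0#
  negateIf-≈0 b x≈0 = trans (negateIf-cong b x≈0) (negateIf-0# b)
    where
    negateIf-0# : ∀ b → negateIf b 0# ≈ 0#
    negateIf-0# false = refl
    negateIf-0# true  = -0#≈0#

  negateIf-≉0 : ∀ b {x} → ¬ (x ≈ 0#) → ¬ (negateIf b x ≈ 0#)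
  negateIf-≉0 false x≉0 = x≉0
  negateIf-≉0 true  x≉0 -x≈0 = x≉0 (trans (sym (-‿involutive _)) (negateIf-≈0 true -x≈0))

  0<negateIf-isNegative : ∀ {x} → ¬ (x ≈ 0#) → 0# < negateIf (does (x <? 0#)) x
  0<negateIf-isNegative {x} x≉0 with x <? 0#
  ... | yes x<0 = neg-pos x<0
  ... | no x≮0 with compare 0# x
  ...   | tri< 0<x _ _ = 0<x
  ...   | tri≈ _ 0≈x _ = contradiction (sym 0≈x) x≉0
  ...   | tri> _ _ x<0 = contradiction x<0 x≮0

  sumFin-cong : ∀ {n} {f g : Fin n → Carrier} → (∀ i → f i ≈ g i) → sumFin ℝ f ≈ sumFin ℝ g
  sumFin-cong {zero}  f≈g = refl
  sumFin-cong {suc n} f≈g = +-cong (f≈g fzero) (sumFin-cong (f≈g ∘ fsuc))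

  sumFin-≈0 : ∀ {n} {f : Fin n → Carrier} → (∀ i → f i ≈ 0#) → sumFin ℝ f ≈ 0#
  sumFin-≈0 {zero}  f≈0 = refl
  sumFin-≈0 {suc n} f≈0 = trans (+-cong (f≈0 fzero) (sumFin-≈0 (f≈0 ∘ fsuc))) (+-identityʳ 0#)

  sumFin-sub : ∀ {n} (f g : Fin n → Carrier) → sumFin ℝ f - sumFin ℝ g ≈ sumFin ℝ (λ i → f i - g i)
  sumFin-sub {zero}  f g = -‿inverseʳ 0#
  sumFin-sub {suc n} f g =
    trans ([x+y]-[z+w]≈[x-z]+[y-w] _ _ _ _) (+-congˡ (sumFin-sub (f ∘ fsuc) (g ∘ fsuc)))

  sumFin-neg : ∀ {n} (f : Fin n → Carrier) → - sumFin ℝ f ≈ sumFin ℝ (λ i → - f i)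
  sumFin-neg {zero}  f = -0#≈0#
  sumFin-neg {suc n} f = trans (sym (-‿+-comm _ _)) (+-congˡ (sumFin-neg (f ∘ fsuc)))

  negateIf-sumFin : ∀ {n} b (f : Fin n → Carrier) → negateIf b (sumFin ℝ f) ≈ sumFin ℝ (negateIf b ∘ f)
  negateIf-sumFin false f = refl
  negateIf-sumFin true  f = sumFin-neg f

  sumFin-nonneg : ∀ {n} {f : Fin n → Carrier} → (∀ i → 0# ≤ f i) → 0# ≤ sumFin ℝ f
  sumFin-nonneg {zero}  0≤f = inj₂ refl
  sumFin-nonneg {suc n} 0≤f = +-nonneg (0≤f fzero) (sumFin-nonneg (0≤f ∘ fsuc))

  sumFin-pos : ∀ {n} {f : Fin n → Carrier} → (∀ i → 0# ≤ f i) → ∀ i → 0# < f i → 0# < sumFin ℝ f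
  sumFin-pos {suc n} 0≤f fzero    0<fi = +-pos-nonneg 0<fi (sumFin-nonneg (0≤f ∘ fsuc))
  sumFin-pos {suc n} 0≤f (fsuc i) 0<fi =
    <-respʳ-≈ (+-comm _ _) (+-pos-nonneg (sumFin-pos (0≤f ∘ fsuc) i 0<fi) (0≤f fzero))

  prodFin : ∀ {m} → (Fin m → Carrier) → Carrier
  prodFin {zero}  f = 1#
  prodFin {suc m} f = f fzero * prodFin (f ∘ fsuc)

  prodFin-≈0 : ∀ {m} (f : Fin m → Carrier) j → f j ≈ 0# → prodFin f ≈ 0#
  prodFin-≈0 f fzero    fj≈0 = trans (*-congʳ fj≈0) (zeroˡ _)
  prodFin-≈0 f (fsuc j) fj≈0 = trans (*-congˡ (prodFin-≈0 (f ∘ fsuc) j fj≈0)) (zeroʳ _)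

  prodFin-≉0 : ∀ {m} {f : Fin m → Carrier} → (∀ j → ¬ (f j ≈ 0#)) → ¬ (prodFin f ≈ 0#)
  prodFin-≉0 {zero}  f≉0 = 1≉0
  prodFin-≉0 {suc m} f≉0 = *-≉0 (f≉0 fzero) (prodFin-≉0 (f≉0 ∘ fsuc))

  Affine : ∀ {n} → (Vertex n → Carrier) → Set (c ⊔ ℓ)
  Affine {n} A = Σ (Fin n → Carrier) λ a → Σ Carrier λ a₀ → ∀ w → A w ≈ dot ℝ a (cubePt ℝ w) + a₀

  affine-const : ∀ {n} x → Affine {n} (λ _ → x)
  affine-const x = (λ _ → 0#) , x , λ w →
    sym (trans (+-congʳ (sumFin-≈0 (λ i → zeroˡ (cubePt ℝ w i)))) (+-identityˡ x))

  affine-restrict : ∀ {n} {A : Vertex (suc n) → Carrier} b → Affine A → Affine (λ w → A (b ◂ w))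
  affine-restrict b (a , a₀ , A≈) =
    a ∘ fsuc , a fzero * bit ℝ b + a₀ , λ w → trans (A≈ (b ◂ w)) ([x+y]+z≈y+[x+z] _ _ _)

  affine-step : ∀ {n} {A : Vertex (suc n) → Carrier} → Affine A →
                Σ Carrier λ δ → ∀ w → A (true ◂ w) ≈ A (false ◂ w) + δ
  affine-step {A = A} (a , a₀ , A≈) = a fzero , step
    where
    step : ∀ w → A (true ◂ w) ≈ A (false ◂ w) + a fzero
    step w = begin
      A (true ◂ w)                          ≈⟨ A≈ (true ◂ w) ⟩
      (a fzero * 1# + aw) + a₀              ≈⟨ +-congʳ (+-congʳ (*-identityʳ _)) ⟩
      (a fzero + aw) + a₀                   ≈⟨ [x+y]+z≈[y+z]+x _ _ _ ⟩
      (aw + a₀) + a fzero                   ≈⟨ +-congʳ (+-congʳ (+-identityˡ aw)) ⟨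
      ((0# + aw) + a₀) + a fzero            ≈⟨ +-congʳ (+-congʳ (+-congʳ (zeroʳ _))) ⟨
      ((a fzero * 0# + aw) + a₀) + a fzero  ≈⟨ +-congʳ (A≈ (false ◂ w)) ⟨
      A (false ◂ w) + a fzero               ∎
      where aw = dot ℝ (a ∘ fsuc) (cubePt ℝ w)

  data Degree≤ {n : ℕ} : ℕ → (Vertex n → Carrier) → Set (c ⊔ ℓ) where
    const   : ∀ {d} x → Degree≤ d (λ _ → x)
    affine* : ∀ {d A f} → Affine A → Degree≤ d f → Degree≤ (suc d) (λ w → A w * f w)
    add     : ∀ {d f g} → Degree≤ d f → Degree≤ d g → Degree≤ d (λ w → f w + g w)
    resp    : ∀ {d f g} → (∀ w → f w ≈ g w) → Degree≤ d f → Degree≤ d g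

  degree-restrict : ∀ {n d} {f : Vertex (suc n) → Carrier} b → Degree≤ d f → Degree≤ d (λ w → f (b ◂ w))
  degree-restrict b (const x)     = const x
  degree-restrict b (affine* α f) = affine* (affine-restrict b α) (degree-restrict b f)
  degree-restrict b (add f g)     = add (degree-restrict b f) (degree-restrict b g)
  degree-restrict b (resp f≈g f)  = resp (f≈g ∘ (b ◂_)) (degree-restrict b f)

  degree-scale : ∀ {n d} {f : Vertex n → Carrier} x → Degree≤ d f → Degree≤ d (λ w → x * f w)
  degree-scale x (const y) = const (x * y)
  degree-scale x (affine* {A = A} {f} α df) =
    resp (λ w → x[yz]≈y[xz] (A w) x (f w)) (affine* α (degree-scale x df))
  degree-scale x (add {f = f} {g} df dg) =
    resp (λ w → sym (distribˡ x (f w) (g w))) (add (degree-scale x df) (degree-scale x dg))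
  degree-scale x (resp f≈g df) = resp (λ w → *-congˡ (f≈g w)) (degree-scale x df)

  degree0-const : ∀ {n} {f : Vertex n → Carrier} → Degree≤ 0 f → Σ Carrier λ x → ∀ w → f w ≈ x
  degree0-const (const x) = x , λ _ → refl
  degree0-const (add df dg) with degree0-const df | degree0-const dg
  ... | x , f≈x | y , g≈y = x + y , λ w → +-cong (f≈x w) (g≈y w)
  degree0-const (resp f≈g df) with degree0-const df
  ... | x , f≈x = x , λ w → trans (sym (f≈g w)) (f≈x w)

  Δ : ∀ {n} → (Vertex (suc n) → Carrier) → Vertex n → Carrier
  Δ f w = f (false ◂ w) - f (true ◂ w)

  Δ-degree0 : ∀ {n} {f : Vertex (suc n) → Carrier} → Degree≤ 0 f → ∀ w → Δ f w ≈ 0#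
  Δ-degree0 df w with degree0-const df
  ... | x , f≈x = trans (+-cong (f≈x _) (-‿cong (f≈x _))) (-‿inverseʳ x)

  Δ-degree : ∀ {n d} {f : Vertex (suc n) → Carrier} → Degree≤ (suc d) f → Degree≤ d (Δ f)
  Δ-degree (const x) = resp (λ _ → sym (-‿inverseʳ x)) (const 0#)
  Δ-degree {d = d} (affine* {A = A} {f = h} α dh) with affine-step α
  ... | δ , A₁≈A₀+δ = resp Δ[Ah]≈ (add (A₀Δh d dh) (degree-scale (- δ) (degree-restrict true dh)))
    where
    A₀Δh : ∀ d → Degree≤ d h → Degree≤ d (λ w → A (false ◂ w) * Δ h w)
    A₀Δh zero    dh = resp (λ w → sym (trans (*-congˡ (Δ-degree0 dh w)) (zeroʳ _))) (const 0#)
    A₀Δh (suc d) dh = affine* (affine-restrict false α) (Δ-degree dh)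
    Δ[Ah]≈ : ∀ w → A (false ◂ w) * Δ h w + - δ * h (true ◂ w) ≈ Δ (λ v → A v * h v) w
    Δ[Ah]≈ w = trans (x[p-q]+[-y]q≈xp-[x+y]q _ _ _ _) (+-congˡ (-‿cong (*-congʳ (sym (A₁≈A₀+δ w)))))
  Δ-degree (add df dg) =
    resp (λ w → sym ([x+y]-[z+w]≈[x-z]+[y-w] _ _ _ _)) (add (Δ-degree df) (Δ-degree dg))
  Δ-degree (resp f≈g df) = resp (λ w → +-cong (f≈g _) (-‿cong (f≈g _))) (Δ-degree df)

  prodFin-degree : ∀ {n m} (F : Fin m → Vertex n → Carrier) → (∀ j → Affine (F j)) →
                   Degree≤ m (λ w → prodFin (λ j → F j w))
  prodFin-degree {m = zero}  F α = const 1#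
  prodFin-degree {m = suc m} F α = affine* (α fzero) (prodFin-degree (F ∘ fsuc) (α ∘ fsuc))

  -- faceSum f S u = Σ (-1)^∣{i ∈ S : w i = true}∣ f w over the vertices w with OnFace S u w.
  faceSum : ∀ {n} → (Vertex n → Carrier) → Subset n → Vertex n → Carrier
  faceSum f []            u = f u
  faceSum f (outside ∷ S) u = faceSum (λ w → f (head u ◂ w)) S (tail u)
  faceSum f (inside  ∷ S) u = faceSum (Δ f) S (tail u)

  faceSum-≈0 : ∀ {n} {f : Vertex n → Carrier} S u → (∀ w → f w ≈ 0#) → faceSum f S u ≈ 0#
  faceSum-≈0 []            u f≈0 = f≈0 u
  faceSum-≈0 (outside ∷ S) u f≈0 = faceSum-≈0 S (tail u) (f≈0 ∘ (head u ◂_))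
  faceSum-≈0 (inside  ∷ S) u f≈0 =
    faceSum-≈0 S (tail u) (λ w → trans (+-cong (f≈0 _) (-‿cong (f≈0 _))) (-‿inverseʳ 0#))

  faceSum-vanishes : ∀ {n d} {f : Vertex n → Carrier} S u →
                     Degree≤ d f → d ℕ.< ∣ S ∣ → faceSum f S u ≈ 0#
  faceSum-vanishes (outside ∷ S) u df d<∣S∣ =
    faceSum-vanishes S (tail u) (degree-restrict (head u) df) d<∣S∣
  faceSum-vanishes {d = zero}  (inside ∷ S) u df _ = faceSum-≈0 S (tail u) (Δ-degree0 df)
  faceSum-vanishes {d = suc d} (inside ∷ S) u df (s≤s d<∣S∣) =
    faceSum-vanishes S (tail u) (Δ-degree df) d<∣S∣

  faceSum-≉0 : ∀ {n} {f : Vertex n → Carrier} S u →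
               (∀ w → w ≗ u → ¬ (f w ≈ 0#)) →
               (∀ w i → OnFace S u w → w i ≢ u i → f w ≈ 0#) →
               ¬ (faceSum f S u ≈ 0#)
  faceSum-≉0 []            u f≉0 f≈0 = f≉0 u (λ _ → ≡.refl)
  faceSum-≉0 (outside ∷ S) u f≉0 f≈0 = faceSum-≉0 S (tail u)
    (λ w w≗ → f≉0 _ (head◂-≗ w≗))
    (λ w i w∈F w≢ → f≈0 _ (fsuc i) (onFace-outside w∈F) w≢)
  faceSum-≉0 {f = f} (inside ∷ S) u f≉0 f≈0 = faceSum-≉0 S (tail u) Δf≉0 Δf≈0
    where
    Δ≈0⇒≈ : ∀ {w} b → Δ f w ≈ 0# → f (b ◂ w) ≈ f (not b ◂ w)
    Δ≈0⇒≈ false Δf≈0 = x∙y⁻¹≈ε⇒x≈y _ _ Δf≈0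
    Δ≈0⇒≈ true  Δf≈0 = sym (x∙y⁻¹≈ε⇒x≈y _ _ Δf≈0)

    Δf≉0 : ∀ w → w ≗ tail u → ¬ (Δ f w ≈ 0#)
    Δf≉0 w w≗ Δf≈0 = f≉0 _ (head◂-≗ w≗) (trans (Δ≈0⇒≈ (head u) Δf≈0)
      (f≈0 _ fzero (onFace-inside _ (λ i _ → w≗ i)) (not-¬ ≡.refl ∘ ≡.sym)))

    Δf≈0 : ∀ w i → OnFace S (tail u) w → w i ≢ tail u i → Δ f w ≈ 0#
    Δf≈0 w i w∈F w≢ = trans (+-cong (vanishes false) (-‿cong (vanishes true))) (-‿inverseʳ 0#)
      where
      vanishes : ∀ b → f (b ◂ w) ≈ 0#
      vanishes b = f≈0 _ (fsuc i) (onFace-inside b w∈F) w≢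

  form : ∀ {n} → Hyperplane ℝ n → Vertex n → Carrier
  form H w = dot ℝ (Hyperplane.normal H) (cubePt ℝ w) - Hyperplane.offset H

  form-affine : ∀ {n} (H : Hyperplane ℝ n) → Affine (form H)
  form-affine H = Hyperplane.normal H , - Hyperplane.offset H , λ w → refl

  form-cong : ∀ {n} (H : Hyperplane ℝ n) {v w} → v ≗ w → form H v ≈ form H w
  form-cong H v≗w = +-congʳ (sumFin-cong (λ i → *-congˡ (reflexive (≡.cong (bit ℝ) (v≗w i)))))

  form≈0⇒∈H : ∀ {n} (H : Hyperplane ℝ n) {w} → form H w ≈ 0# → _∈H_ ℝ (cubePt ℝ w) H
  form≈0⇒∈H H = x∙y⁻¹≈ε⇒x≈y _ _

  ∈H⇒form≈0 : ∀ {n} (H : Hyperplane ℝ n) {w} → _∈H_ ℝ (cubePt ℝ w) H → form H w ≈ 0#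
  ∈H⇒form≈0 H = x≈y⇒x∙y⁻¹≈ε

  bit-difference-≡ : ∀ a {x y} → x ≡ y → a * bit ℝ x - a * bit ℝ y ≈ 0#
  bit-difference-≡ a ≡.refl = -‿inverseʳ _

  bit-difference : ∀ a {x y} → x ≢ y → a * bit ℝ x - a * bit ℝ y ≈ negateIf y a
  bit-difference a {true}  {false} _ = trans (+-cong (*-identityʳ a) (-‿cong (zeroʳ a)))
                                            (trans (+-congˡ -0#≈0#) (+-identityʳ a))
  bit-difference a {false} {true}  _ = trans (+-cong (zeroʳ a) (-‿cong (*-identityʳ a))) (+-identityˡ (- a))
  bit-difference a {true}  {true}  x≢y = contradiction ≡.refl x≢y
  bit-difference a {false} {false} x≢y = contradiction ≡.refl x≢y

  module SmallCover {n m : ℕ} (H : Fin m → Hyperplane ℝ n)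
    (covers : (v : Vertex n) (i : Fin n) →
              Σ (Fin m) λ j → _∈H_ ℝ (cubePt ℝ v) (H j) × ¬ (Hyperplane.normal (H j) i ≈ 0#))
    (2m<n : 2 ℕ.* m ℕ.< n) where

    a : Fin m → Fin n → Carrier
    a j = Hyperplane.normal (H j)

    Through : Fin m → Vertex n → Set ℓ
    Through j w = _∈H_ ℝ (cubePt ℝ w) (H j)

    Through? : ∀ w → Decidable (λ j → Through j w)
    Through? w j = _ ≟ _

    through : Vertex n → Subset m
    through w = subsetOf (Through? w)

    module AtVertex (u : Vertex n) where

      Covers : Fin n → Fin m → Set ℓ
      Covers i j = Through j u × ¬ (a j i ≈ 0#)

      leastCover : ∀ i → ∃ λ j → Covers i j × (∀ {k} → k Fin.< j → ¬ Covers i k)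
      leastCover i = smallest-witness (λ j → Through? u j ×-dec ¬? (a j i ≟ 0#)) (covers u i)

      first : Fin n → Fin m
      first i = proj₁ (leastCover i)

      u∈first : ∀ i → Through (first i) u
      u∈first i = proj₁ (proj₁ (proj₂ (leastCover i)))

      a-first≉0 : ∀ i → ¬ (a (first i) i ≈ 0#)
      a-first≉0 i = proj₂ (proj₁ (proj₂ (leastCover i)))

      a≈0-before-first : ∀ {i j} → j Fin.< first i → Through j u → a j i ≈ 0#
      a≈0-before-first {i} {j} j<first u∈j =
        decidable-stable (a j i ≟ 0#) (λ a≉0 → proj₂ (proj₂ (leastCover i)) j<first (u∈j , a≉0))

      -- the change of ⟨a (first i), x⟩ when coordinate i of x = u is flipped (bit-difference)
      increment : Fin n → Carrier
      increment i = negateIf (u i) (a (first i) i)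

      sign : Fin n → Bool
      sign i = does (increment i <? 0#)

      0<signed-increment : ∀ σ {i} → i ∈ fibre sign σ → 0# < negateIf σ (increment i)
      0<signed-increment σ {i} i∈S = ≡.subst (λ b → 0# < negateIf b (increment i))
        (∈-subsetOf⁻ (λ i → sign i Bool.≟ σ) i∈S)
        (0<negateIf-isNegative (negateIf-≉0 (u i) (a-first≉0 i)))

      Moved : Vertex n → Fin m → Set
      Moved w j = ∃ λ i → w i ≢ u i × first i ≡ j

      Moved? : ∀ w → Decidable (Moved w)
      Moved? w j = Finₚ.any? (λ i → ¬? (w i Bool.≟ u i) ×-dec (first i Fin.≟ j))

      separation : ∀ σ w i → OnFace (fibre sign σ) u w → w i ≢ u i →
                   ∃ λ j → Through j u × ¬ Through j w
      separation σ w i₀ w∈F w₀≢u₀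
        with smallest-witness (Moved? w) (first i₀ , i₀ , w₀≢u₀ , ≡.refl)
      ... | j , (i₁ , w₁≢u₁ , first₁≡j) , unmoved-below = j , u∈j , w∉j
        where
        u∈j : Through j u
        u∈j = ≡.subst (λ k → Through k u) first₁≡j (u∈first i₁)

        t : Fin n → Carrier
        t i = a j i * bit ℝ (w i) - a j i * bit ℝ (u i)

        t-pos : ∀ {i} → w i ≢ u i → first i ≡ j → 0# < negateIf σ (t i)
        t-pos {i} w≢u first≡j = <-respʳ-≈ (negateIf-cong σ increment≈t) (0<signed-increment σ i∈S)
          where
          increment≈t : increment i ≈ t i
          increment≈t = trans (reflexive (≡.cong (λ k → negateIf (u i) (a k i)) first≡j))
                              (sym (bit-difference _ w≢u))
          i∈S : i ∈ fibre sign σ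
          i∈S = decidable-stable (i ∈? _) (λ i∉S → w≢u (w∈F i i∉S))

        ≈0⇒nonneg : ∀ {x} → x ≈ 0# → 0# ≤ negateIf σ x
        ≈0⇒nonneg x≈0 = inj₂ (sym (negateIf-≈0 σ x≈0))

        t-nonneg : ∀ i → 0# ≤ negateIf σ (t i)
        t-nonneg i with w i Bool.≟ u i | first i Fin.≟ j
        ... | yes w≡u | _          = ≈0⇒nonneg (bit-difference-≡ _ w≡u)
        ... | no w≢u  | yes first≡j = inj₁ (t-pos w≢u first≡j)
        ... | no w≢u  | no first≢j  =
          ≈0⇒nonneg (trans (bit-difference _ w≢u) (negateIf-≈0 (u i) (a≈0-before-first j<first u∈j)))
          where
          j<first : j Fin.< first i
          j<first = Finₚ.≤∧≢⇒< (ℕₚ.≮⇒≥ (λ first<j → unmoved-below first<j (i , w≢u , ≡.refl)))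
                               (first≢j ∘ ≡.sym)

        w∉j : ¬ Through j w
        w∉j w∈j = irrefl (sym (negateIf-≈0 σ Σt≈0)) 0<±Σt
          where
          Σt≈0 : sumFin ℝ t ≈ 0#
          Σt≈0 = trans (sym (sumFin-sub (λ i → a j i * bit ℝ (w i)) (λ i → a j i * bit ℝ (u i))))
                       (x≈y⇒x∙y⁻¹≈ε (trans w∈j (sym u∈j)))
          0<±Σt : 0# < negateIf σ (sumFin ℝ t)
          0<±Σt = <-respʳ-≈ (sym (negateIf-sumFin σ t))
                            (sumFin-pos t-nonneg i₁ (t-pos w₁≢u₁ first₁≡j))

      fewer-through : ∀ σ w i → OnFace (fibre sign σ) u w → w i ≢ u i →
                      (∀ j → Through j w → Through j u) → ∣ through w ∣ ℕ.< ∣ through u ∣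
      fewer-through σ w i w∈F w≢u w⇒u with separation σ w i w∈F w≢u
      ... | j , u∈j , w∉j = p⊂q⇒∣p∣<∣q∣
        ( (λ {k} k∈ → ∈-subsetOf⁺ (Through? u) (w⇒u k (∈-subsetOf⁻ (Through? w) k∈)))
        , j , ∈-subsetOf⁺ (Through? u) u∈j , w∉j ∘ ∈-subsetOf⁻ (Through? w))

      factor : Fin m → Vertex n → Carrier
      factor j with Through? u j
      ... | yes _ = λ _ → 1#
      ... | no _  = form (H j)

      factor-affine : ∀ j → Affine (factor j)
      factor-affine j with Through? u j
      ... | yes _ = affine-const 1#
      ... | no _  = form-affine (H j)

      factor-≉0 : ∀ j w → w ≗ u → ¬ (factor j w ≈ 0#)
      factor-≉0 j w w≗u with Through? u j
      ... | yes _   = 1≉0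
      ... | no u∉j = λ form≈0 →
        u∉j (form≈0⇒∈H (H j) {u} (trans (form-cong (H j) (≡.sym ∘ w≗u)) form≈0))

      factor-≈0 : ∀ j w → Through j w → ¬ Through j u → factor j w ≈ 0#
      factor-≈0 j w w∈j u∉j with Through? u j
      ... | yes u∈j = contradiction u∈j u∉j
      ... | no _    = ∈H⇒form≈0 (H j) {w} w∈j

      productOfMissedForms : Vertex n → Carrier
      productOfMissedForms w = prodFin (λ j → factor j w)

      minimal⇒⊥ : (∀ w → ∣ through w ∣ ℕ.< ∣ through u ∣ → ⊥) → ⊥
      minimal⇒⊥ fewer⇒⊥ = faceSum-≉0 S u g≉0 g≈0
        (faceSum-vanishes S u (prodFin-degree factor factor-affine) (proj₂ (majority sign 2m<n)))
        where
        σ = proj₁ (majority sign 2m<n)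
        S = fibre sign σ

        g≉0 : ∀ w → w ≗ u → ¬ (productOfMissedForms w ≈ 0#)
        g≉0 w w≗u = prodFin-≉0 (λ j → factor-≉0 j w w≗u)

        g≈0 : ∀ w i → OnFace S u w → w i ≢ u i → productOfMissedForms w ≈ 0#
        g≈0 w i w∈F w≢u with Finₚ.any? (λ j → Through? w j ×-dec ¬? (Through? u j))
        ... | yes (j , w∈j , u∉j) = prodFin-≈0 _ j (factor-≈0 j w w∈j u∉j)
        ... | no ∄ = ⊥-elim (fewer⇒⊥ w (fewer-through σ w i w∈F w≢u λ j w∈j →
          decidable-stable (Through? u j) (λ u∉j → ∄ (j , w∈j , u∉j))))

    impossible : ⊥
    impossible = descend (λ _ → false) (wellFounded (∣_∣ ∘ through) <-wellFounded _)
      where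
      descend : ∀ u → Acc (ℕ._<_ on (∣_∣ ∘ through)) u → ⊥
      descend u (acc rs) = AtVertex.minimal⇒⊥ u (λ w fewer → descend w (rs fewer))

-- Opened only here: inside the module above, _≤_ and _*_ are those of the field.
open import Data.Nat using (_≤_; _*_)

theorem1p1 : {c ℓ : Level} (ℝ : RealField c ℓ) (n : ℕ) → 1 ≤ n →
    (m : ℕ) (H : Fin m → Hyperplane ℝ n) →
    ((v : Fin n → Bool) (i : Fin n) →
      Σ (Fin m) (λ j → _∈H_ ℝ (cubePt ℝ v) (H j) ×
        ¬ (RealField._≈_ ℝ (Hyperplane.normal (H j) i) (RealField.0# ℝ)))) →
    n ≤ 2 * m
theorem1p1 ℝ n _ m H covers = decidable-stable (n ℕ.≤? 2 * m) λ n≰2m →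
  SmallCover.impossible ℝ H covers (ℕₚ.≰⇒> n≰2m)
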